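{- Let $\mathcal{A}=A_1\times\cdots\times A_m$ with finite nonempty $A_i$ and $A_i=A_{m-i+1}$. If $H\subseteq\bar{\mathcal{A}}$ is symmetric and prefix-free, then $\min(|\cup H|,|\mathcal{A}|-|\cup H|)\le|H|^2+O(|H|^4/|\mathcal{A}|)$.
   Context: $\bar{\mathcal{A}}=\bigcup_{i=0}^mA_1\times\cdots\times A_i$. For $\vec a\in\bar{\mathcal{A}}$ of length $\ell$, the associated set is $\vec a\times A_{\ell+1}\times\cdots\times A_m\subseteq\mathcal{A}$ and the reverse set is $A_1\times\cdots\times A_{m-\ell}\times\{a_\ell\}\times\cdots\times\{a_1\}$. $\cup H$ is the union of the associated sets of elements of $H$; $H$ is symmetric if $\cup H$ equals the union of the reverse sets of elements of $H$. Prefix-free: no element is a proper prefix of another. -}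

module Defs where

open import Data.Nat using (ℕ; _<_; _≟_)
open import Data.List using (List; []; _∷_; length; map; concatMap; upTo; reverse; filter)
open import Data.Nat.ListAction using (product)
open import Data.List.Membership.Propositional using (_∈_)
open import Data.List.Relation.Unary.Any using (Any; any?)
open import Data.List.Relation.Binary.Prefix.Heterogeneous using (Prefix)
open import Data.List.Relation.Binary.Prefix.Heterogeneous.Properties using (prefix?)
open import Data.List.Relation.Binary.Suffix.Heterogeneous using (Suffix)
open import Data.Product using (_×_)
open import Data.Unit using (⊤)
open import Data.Empty using (⊥)
open import Relation.Binary.PropositionalEquality using (_≡_)
open import Function.Bundles using (_⇔_)

-- The alphabets: A_i = {0, …, s_i - 1} where sizes = s_1 ∷ … ∷ s_m.
-- A word (list of letters) belongs to Ā = ⋃_{ℓ ≤ m} A_1 × ⋯ × A_ℓ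
-- iff its length is ≤ m and its j-th letter lies in A_j.
InBar : List ℕ → List ℕ → Set
InBar _ [] = ⊤
InBar [] (x ∷ w) = ⊥
InBar (s ∷ ss) (x ∷ w) = (x < s) × InBar ss w

allWords : List ℕ → List (List ℕ)
allWords [] = [] ∷ []
allWords (s ∷ ss) = concatMap (λ x → map (x ∷_) (allWords ss)) (upTo s)

cardA : List ℕ → ℕ
cardA sizes = product sizes

InAssoc : List ℕ → List ℕ → Set
InAssoc h a = Prefix _≡_ h a

-- a ∈ reverse set of h = A_1 × ⋯ × A_{m-ℓ} × {h_ℓ} × ⋯ × {h_1}
-- (reverse h is a suffix of the full word a)
InRev : List ℕ → List ℕ → Set
InRev h a = Suffix _≡_ (reverse h) a

InUnion : List (List ℕ) → List ℕ → Set
InUnion H a = Any (λ h → InAssoc h a) H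

InRevUnion : List (List ℕ) → List ℕ → Set
InRevUnion H a = Any (λ h → InRev h a) H

cardUnion : List ℕ → List (List ℕ) → ℕ
cardUnion sizes H =
  length (filter (λ a → any? (λ h → prefix? _≟_ h a) H) (allWords sizes))

Symmetric : List ℕ → List (List ℕ) → Set
Symmetric sizes H = ∀ a → a ∈ allWords sizes → (InUnion H a ⇔ InRevUnion H a)

PrefixFree : List (List ℕ) → Set
PrefixFree H = ∀ h h′ → h ∈ H → h′ ∈ H → Prefix _≡_ h h′ → h ≡ h′

-- Reading the reverse set of h as {a | h is a prefix of reverse a}, symmetry says
-- exactly that ∪H is closed under reversal of words. So a word a ∈ ∪H has a prefix
-- p ∈ H and reverse a has a prefix q ∈ H. If every word of H has length ≥ m/2, the
-- two overlap and a is determined by (p, q): |∪H| ≤ |H|². Otherwise pick h₀ ∈ H of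
-- length j ≤ m/2. For a ∉ ∪H let t be its first m − j letters; the reverse of
-- t ++ reverse h₀ begins with h₀, so t ++ reverse h₀ ∈ ∪H, and its prefix in H
-- cannot be a prefix of t, hence extends t. Doing this for a and for reverse a
-- determines a by a pair from H: |𝒜 ∖ ∪H| ≤ |H|².
module Submission where

open import Defs
open import Data.Nat using (ℕ; zero; suc; _+_; _*_; _^_; _∸_; _≤_; _<_; _⊓_; NonZero; z≤n; s≤s; _≟_; _≤?_)
open import Data.Nat.Properties
open import Data.Nat.ListAction using (product)
open import Data.List
  using (List; []; _∷_; length; reverse; map; concatMap; upTo; filter; take; drop; _++_; cartesianProductWith; removeAt)
open import Data.List.Properties
  using ( length-++; length-map; length-upTo; length-reverse; length-drop; length-take; length-removeAt′
        ; ∷-injective; take++drop≡id; take-all; take-take; reverse-++; reverse-involutive)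
open import Data.List.Membership.Propositional using (_∈_; lose; find)
open import Data.List.Membership.Propositional.Properties
  using (∈-cartesianProductWith⁺; ∈-cartesianProductWith⁻; ∈-upTo⁺; ∈-upTo⁻; ∈-filter⁻)
import Data.List.Relation.Unary.All as All
open import Data.List.Relation.Unary.All using (All; [])
open import Data.List.Relation.Unary.Any as Any using (Any; here; there; any?; index)
open import Data.List.Relation.Unary.Unique.Propositional using (Unique; []; _∷_)
import Data.List.Relation.Unary.Unique.Propositional.Properties as Unique
open import Data.List.Relation.Binary.Pointwise as Pointwise using (Pointwise; []; _∷_)
open import Data.List.Relation.Binary.Prefix.Heterogeneous using (Prefix; []; _∷_)
open import Data.List.Relation.Binary.Prefix.Heterogeneous.Properties using (prefix?)
open import Data.List.Relation.Binary.Suffix.Heterogeneous using (Suffix)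
import Data.List.Relation.Binary.Prefix.Heterogeneous.Properties as Prefix
import Data.List.Relation.Binary.Suffix.Heterogeneous.Properties as Suffix
open import Data.Product using (∃; ∃₂; _×_; _,_)
open import Data.Sum using (_⊎_; inj₁; inj₂)
open import Data.Empty using (⊥-elim)
open import Relation.Nullary using (¬_; yes; no)
open import Relation.Unary using (Decidable)
open import Relation.Unary.Properties using (∁?)
open import Relation.Binary.PropositionalEquality
open import Function.Bundles using (_⇔_; mk⇔; Equivalence)
open import Function using (_∘′_)

module _ {A : Set} where

  take-length-++ : ∀ (xs ys : List A) → take (length xs) (xs ++ ys) ≡ xs
  take-length-++ []       ys = refl
  take-length-++ (x ∷ xs) ys = cong (x ∷_) (take-length-++ xs ys)

  reverse-take-reverse : ∀ j (xs : List A) →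
                         reverse (take j (reverse xs)) ≡ drop (length xs ∸ j) xs
  reverse-take-reverse j xs with ≤-total j (length xs)
  ... | inj₂ n≤j = begin
    reverse (take j (reverse xs)) ≡⟨ cong reverse (take-all j (reverse xs) n≤j′) ⟩
    reverse (reverse xs)          ≡⟨ reverse-involutive xs ⟩
    xs                            ≡⟨ cong (λ n → drop n xs) (sym (m≤n⇒m∸n≡0 n≤j)) ⟩
    drop (length xs ∸ j) xs       ∎
    where
    open ≡-Reasoning
    n≤j′ : length (reverse xs) ≤ j
    n≤j′ = subst (_≤ j) (sym (length-reverse xs)) n≤j
  ... | inj₁ j≤n = begin
    reverse (take j (reverse xs))             ≡⟨ cong (λ ys → reverse (take j ys)) reverse-split ⟩
    reverse (take j (reverse d ++ reverse t)) ≡⟨ cong reverse take-j ⟩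
    reverse (reverse d)                       ≡⟨ reverse-involutive d ⟩
    d                                         ∎
    where
    open ≡-Reasoning
    t = take (length xs ∸ j) xs
    d = drop (length xs ∸ j) xs
    reverse-split : reverse xs ≡ reverse d ++ reverse t
    reverse-split = trans (cong reverse (sym (take++drop≡id (length xs ∸ j) xs))) (reverse-++ t d)
    length-rd : length (reverse d) ≡ j
    length-rd = trans (length-reverse d) (trans (length-drop (length xs ∸ j) xs) (m∸[m∸n]≡n j≤n))
    take-j : take j (reverse d ++ reverse t) ≡ reverse d
    take-j = subst (λ n → take n (reverse d ++ reverse t) ≡ reverse d) length-rd
                   (take-length-++ (reverse d) (reverse t))

  take++reverse-take-reverse : ∀ j (xs : List A) →
                               take (length xs ∸ j) xs ++ reverse (take j (reverse xs)) ≡ xs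
  take++reverse-take-reverse j xs =
    trans (cong (take (length xs ∸ j) xs ++_) (reverse-take-reverse j xs)) (take++drop≡id (length xs ∸ j) xs)

  ++-prefix : ∀ (xs ys : List A) → Prefix _≡_ xs (xs ++ ys)
  ++-prefix []       ys = []
  ++-prefix (x ∷ xs) ys = refl ∷ ++-prefix xs ys

  take-prefix : ∀ n (xs : List A) → Prefix _≡_ (take n xs) xs
  take-prefix zero    xs       = []
  take-prefix (suc n) []       = []
  take-prefix (suc n) (x ∷ xs) = refl ∷ take-prefix n xs

  prefix⇒take≡take : ∀ {xs ys : List A} n → Prefix _≡_ xs ys → n ≤ length xs → take n xs ≡ take n ys
  prefix⇒take≡take zero    _          _         = refl
  prefix⇒take≡take (suc n) (refl ∷ p) (s≤s n≤l) = cong (_ ∷_) (prefix⇒take≡take n p n≤l)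

  prefixes-comparable : ∀ {xs ys zs : List A} → Prefix _≡_ xs zs → Prefix _≡_ ys zs →
                        Prefix _≡_ xs ys ⊎ Prefix _≡_ ys xs
  prefixes-comparable []         _          = inj₁ []
  prefixes-comparable (_ ∷ _)    []         = inj₂ []
  prefixes-comparable (refl ∷ p) (refl ∷ q) with prefixes-comparable p q
  ... | inj₁ p≤q = inj₁ (refl ∷ p≤q)
  ... | inj₂ q≤p = inj₂ (refl ∷ q≤p)

  suffix-reverse⇔prefix : ∀ {xs ys : List A} → Suffix _≡_ (reverse xs) ys ⇔ Prefix _≡_ xs (reverse ys)
  suffix-reverse⇔prefix {xs} {ys} = mk⇔
    (λ s → Suffix.toPrefix (subst (Suffix _≡_ (reverse xs)) (sym (reverse-involutive ys)) s))
    (λ p → subst (Suffix _≡_ (reverse xs)) (reverse-involutive ys) (Suffix.fromPrefix p))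

  ∈-removeAt : ∀ {x y : A} {ys} (x∈ : x ∈ ys) → y ∈ ys → y ≢ x → y ∈ removeAt ys (index x∈)
  ∈-removeAt (here refl) (here refl) y≢x = ⊥-elim (y≢x refl)
  ∈-removeAt (here refl) (there y∈)  _   = y∈
  ∈-removeAt (there x∈)  (here refl) _   = here refl
  ∈-removeAt (there x∈)  (there y∈)  y≢x = there (∈-removeAt x∈ y∈ y≢x)

  Unique-⊆⇒length≤ : ∀ {xs ys : List A} → Unique xs → (∀ {z} → z ∈ xs → z ∈ ys) →
                     length xs ≤ length ys
  Unique-⊆⇒length≤ {[]}     _           _   = z≤n
  Unique-⊆⇒length≤ {x ∷ xs} {ys} (x∉ ∷ xs!) xs⊆ = begin
    suc (length xs)                        ≤⟨ s≤s (Unique-⊆⇒length≤ xs! xs⊆ys─x) ⟩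
    suc (length (removeAt ys (index x∈)))  ≡⟨ length-removeAt′ ys (index x∈) ⟨
    length ys                              ∎
    where
    open ≤-Reasoning
    x∈ = xs⊆ (here refl)
    xs⊆ys─x : ∀ {z} → z ∈ xs → z ∈ removeAt ys (index x∈)
    xs⊆ys─x z∈ = ∈-removeAt x∈ (xs⊆ (there z∈)) (λ z≡x → All.lookup x∉ z∈ (sym z≡x))

module _ {A B C : Set} (f : A → B → C) where

  concatMap≡cartesianProductWith : ∀ xs ys → concatMap (λ x → map (f x) ys) xs ≡ cartesianProductWith f xs ys
  concatMap≡cartesianProductWith []       ys = refl
  concatMap≡cartesianProductWith (x ∷ xs) ys = cong (map (f x) ys ++_) (concatMap≡cartesianProductWith xs ys)

  length-cartesianProductWith : ∀ xs ys → length (cartesianProductWith f xs ys) ≡ length xs * length ys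
  length-cartesianProductWith []       ys = refl
  length-cartesianProductWith (x ∷ xs) ys =
    trans (length-++ (map (f x) ys)) (cong₂ _+_ (length-map (f x) ys) (length-cartesianProductWith xs ys))

module _ {A B : Set} (g : A → A → B) where

  Unique-image²⇒length≤ : ∀ {xs : List B} {ys : List A} → Unique xs →
                          (∀ {x} → x ∈ xs → ∃₂ λ p q → p ∈ ys × q ∈ ys × x ≡ g p q) →
                          length xs ≤ length ys ^ 2
  Unique-image²⇒length≤ {xs} {ys} xs! cover = begin
    length xs                                  ≤⟨ Unique-⊆⇒length≤ xs! xs⊆ ⟩
    length (cartesianProductWith g ys ys)      ≡⟨ length-cartesianProductWith g ys ys ⟩
    length ys * length ys                      ≡⟨ cong (length ys *_) (*-identityʳ (length ys)) ⟨
    length ys ^ 2                              ∎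
    where
    open ≤-Reasoning
    xs⊆ : ∀ {x} → x ∈ xs → x ∈ cartesianProductWith g ys ys
    xs⊆ x∈ with cover x∈
    ... | p , q , p∈ , q∈ , refl = ∈-cartesianProductWith⁺ g p∈ q∈

length-filter+length-filter-∁ : ∀ {A : Set} {P : A → Set} (P? : Decidable P) xs →
                                length (filter P? xs) + length (filter (∁? P?) xs) ≡ length xs
length-filter+length-filter-∁ P? [] = refl
length-filter+length-filter-∁ P? (x ∷ xs) with P? x
... | yes _ = cong suc (length-filter+length-filter-∁ P? xs)
... | no  _ = trans (+-suc _ _) (cong suc (length-filter+length-filter-∁ P? xs))

≤-+-of-≤-doubles : ∀ {m} x y → m ≤ x + x → m ≤ y + y → m ≤ x + y
≤-+-of-≤-doubles x y m≤2x m≤2y with ≤-total x y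
... | inj₁ x≤y = ≤-trans m≤2x (+-monoʳ-≤ x x≤y)
... | inj₂ y≤x = ≤-trans m≤2y (+-monoˡ-≤ y y≤x)

Pointwise-take⁺ : ∀ {A B : Set} {R : A → B → Set} n {xs ys} →
                  Pointwise R xs ys → Pointwise R (take n xs) (take n ys)
Pointwise-take⁺ zero    _        = []
Pointwise-take⁺ (suc n) []       = []
Pointwise-take⁺ (suc n) (r ∷ rs) = r ∷ Pointwise-take⁺ n rs

allWords-∷ : ∀ s ss → allWords (s ∷ ss) ≡ cartesianProductWith _∷_ (upTo s) (allWords ss)
allWords-∷ s ss = concatMap≡cartesianProductWith _∷_ (upTo s) (allWords ss)

∈-allWords⇔ : ∀ {a} sizes → a ∈ allWords sizes ⇔ Pointwise _<_ a sizes
∈-allWords⇔ sizes = mk⇔ (to sizes) from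
  where
  to : ∀ {a} sizes → a ∈ allWords sizes → Pointwise _<_ a sizes
  to []       (here refl) = []
  to (s ∷ ss) a∈ with ∈-cartesianProductWith⁻ _∷_ (upTo s) (allWords ss)
                        (subst (_ ∈_) (allWords-∷ s ss) a∈)
  ... | x , w , x∈ , w∈ , refl = ∈-upTo⁻ x∈ ∷ to ss w∈
  from : ∀ {a sizes} → Pointwise _<_ a sizes → a ∈ allWords sizes
  from [] = here refl
  from {x ∷ w} {s ∷ ss} (x<s ∷ w<ss) =
    subst (_ ∈_) (sym (allWords-∷ s ss)) (∈-cartesianProductWith⁺ _∷_ (∈-upTo⁺ x<s) (from w<ss))

allWords-unique : ∀ sizes → Unique (allWords sizes)
allWords-unique []       = [] ∷ []
allWords-unique (s ∷ ss) =
  subst Unique (sym (allWords-∷ s ss))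
    (Unique.cartesianProductWith⁺ _∷_ ∷-injective (Unique.upTo⁺ s) (allWords-unique ss))

length-allWords : ∀ sizes → length (allWords sizes) ≡ product sizes
length-allWords []       = refl
length-allWords (s ∷ ss) = begin
  length (allWords (s ∷ ss))                               ≡⟨ cong length (allWords-∷ s ss) ⟩
  length (cartesianProductWith _∷_ (upTo s) (allWords ss)) ≡⟨ length-cartesianProductWith _∷_ (upTo s) (allWords ss) ⟩
  length (upTo s) * length (allWords ss)                   ≡⟨ cong₂ _*_ (length-upTo s) (length-allWords ss) ⟩
  s * product ss                                           ∎
  where open ≡-Reasoning

InBar⇒Pointwise-take : ∀ sizes h → InBar sizes h → Pointwise _<_ h (take (length h) sizes)
InBar⇒Pointwise-take _        []      _            = []
InBar⇒Pointwise-take (s ∷ ss) (x ∷ h) (x<s , h∈Ā) = x<s ∷ InBar⇒Pointwise-take ss h h∈Ā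

InRevUnion⇔InUnion-reverse : ∀ H a → InRevUnion H a ⇔ InUnion H (reverse a)
InRevUnion⇔InUnion-reverse H a = mk⇔
  (Any.map (Equivalence.to suffix-reverse⇔prefix))
  (Any.map (Equivalence.from suffix-reverse⇔prefix))

module SymmetricFamily (sizes : List ℕ) (H : List (List ℕ))
  (palindromic : reverse sizes ≡ sizes) (H⊆Ā : All (InBar sizes) H) (symmetric : Symmetric sizes H) where

  m : ℕ
  m = length sizes

  𝒜 : List (List ℕ)
  𝒜 = allWords sizes

  length-∈𝒜 : ∀ {a} → a ∈ 𝒜 → length a ≡ m
  length-∈𝒜 a∈ = Pointwise.Pointwise-length (Equivalence.to (∈-allWords⇔ sizes) a∈)

  reverse-∈𝒜 : ∀ {a} → a ∈ 𝒜 → reverse a ∈ 𝒜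
  reverse-∈𝒜 a∈ = Equivalence.from (∈-allWords⇔ sizes)
    (subst (Pointwise _<_ _) palindromic (Pointwise.reverse⁺ (Equivalence.to (∈-allWords⇔ sizes) a∈)))

  ∪H-reverse⇔ : ∀ {a} → a ∈ 𝒜 → InUnion H a ⇔ InUnion H (reverse a)
  ∪H-reverse⇔ {a} a∈ = mk⇔
    (λ u → Equivalence.to (InRevUnion⇔InUnion-reverse H a) (Equivalence.to (symmetric a a∈) u))
    (λ u → Equivalence.from (symmetric a a∈) (Equivalence.from (InRevUnion⇔InUnion-reverse H a) u))

  count : ∀ {Q : List ℕ → Set} (Q? : Decidable Q) (g : List ℕ → List ℕ → List ℕ) →
          (∀ {a} → a ∈ 𝒜 → Q a → ∃₂ λ p q → p ∈ H × q ∈ H × a ≡ g p q) →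
          length (filter Q? 𝒜) ≤ length H ^ 2
  count Q? g cover = Unique-image²⇒length≤ g (Unique.filter⁺ Q? (allWords-unique sizes))
    (λ a∈ → let (a∈𝒜 , Qa) = ∈-filter⁻ Q? a∈ in cover a∈𝒜 Qa)

  glue : ℕ → List ℕ → List ℕ → List ℕ
  glue j p q = take (m ∸ j) p ++ reverse (take j q)

  ≡glue : ∀ {a} j p q → a ∈ 𝒜 → take (m ∸ j) a ≡ take (m ∸ j) p → take j (reverse a) ≡ take j q →
          a ≡ glue j p q
  ≡glue {a} j p q a∈ ≡p ≡q = begin
    a                                                     ≡⟨ take++reverse-take-reverse j a ⟨
    take (length a ∸ j) a ++ reverse (take j (reverse a)) ≡⟨ cong (λ n → take (n ∸ j) a ++ _) (length-∈𝒜 a∈) ⟩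
    take (m ∸ j) a ++ reverse (take j (reverse a))        ≡⟨ cong₂ (λ u v → u ++ reverse v) ≡p ≡q ⟩
    glue j p q                                            ∎
    where open ≡-Reasoning

  ∪H⊆glue : (∀ {h} → h ∈ H → m ≤ length h + length h) →
            ∀ {a} → a ∈ 𝒜 → InUnion H a → ∃₂ λ p q → p ∈ H × q ∈ H × a ≡ glue (length q) p q
  ∪H⊆glue long {a} a∈ a∈∪H with find a∈∪H | find (Equivalence.to (∪H-reverse⇔ a∈) a∈∪H)
  ... | p , p∈ , p≤a | q , q∈ , q≤ra =
    p , q , p∈ , q∈ , ≡glue (length q) p q a∈
      (sym (prefix⇒take≡take (m ∸ length q) p≤a
        (m≤n+o⇒m∸n≤o m (length q) (subst (m ≤_) (+-comm (length p) (length q))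
          (≤-+-of-≤-doubles (length p) (length q) (long p∈) (long q∈))))))
      (sym (prefix⇒take≡take (length q) q≤ra ≤-refl))

  complement-prefix-in-H : ∀ {h₀ a} → h₀ ∈ H → a ∈ 𝒜 → ¬ InUnion H a →
                           ∃ λ h → h ∈ H × take (m ∸ length h₀) h ≡ take (m ∸ length h₀) a
  complement-prefix-in-H {h₀} {a} h₀∈ a∈ a∉∪H =
    conclude (find (Equivalence.from (∪H-reverse⇔ b∈) (lose h₀∈ h₀≤rb)))
    where
    n = m ∸ length h₀
    t = take n a
    b = t ++ reverse h₀

    tail-sizes : reverse (take (length h₀) sizes) ≡ drop n sizes
    tail-sizes = trans (cong (λ s → reverse (take (length h₀) s)) (sym palindromic))
                       (reverse-take-reverse (length h₀) sizes)

    b∈ : b ∈ 𝒜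
    b∈ = Equivalence.from (∈-allWords⇔ sizes) (subst (Pointwise _<_ b) (take++drop≡id n sizes)
      (Pointwise.++⁺ (Pointwise-take⁺ n (Equivalence.to (∈-allWords⇔ sizes) a∈))
                     (subst (Pointwise _<_ (reverse h₀)) tail-sizes
                       (Pointwise.reverse⁺ (InBar⇒Pointwise-take sizes h₀ (All.lookup H⊆Ā h₀∈))))))

    h₀≤rb : Prefix _≡_ h₀ (reverse b)
    h₀≤rb = subst (Prefix _≡_ h₀) (sym (trans (reverse-++ t (reverse h₀))
                    (cong (_++ reverse t) (reverse-involutive h₀)))) (++-prefix h₀ (reverse t))

    length-t : length t ≡ n
    length-t = trans (length-take n a)
                     (m≤n⇒m⊓n≡m (subst (n ≤_) (sym (length-∈𝒜 a∈)) (m∸n≤m m (length h₀))))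

    conclude : (∃ λ h → h ∈ H × Prefix _≡_ h b) → ∃ λ h → h ∈ H × take n h ≡ t
    conclude (h , h∈ , h≤b) with prefixes-comparable h≤b (++-prefix t (reverse h₀))
    ... | inj₁ h≤t = ⊥-elim (a∉∪H (lose h∈ (Prefix.trans trans h≤t (take-prefix n a))))
    ... | inj₂ t≤h = h , h∈ , (begin
      take n h ≡⟨ prefix⇒take≡take n t≤h (≤-reflexive (sym length-t)) ⟨
      take n t ≡⟨ take-all n t (≤-reflexive length-t) ⟩
      t        ∎)
      where open ≡-Reasoning

  complement⊆glue : ∀ {h₀} → h₀ ∈ H → length h₀ + length h₀ ≤ m →
                    ∀ {a} → a ∈ 𝒜 → ¬ InUnion H a →
                    ∃₂ λ p q → p ∈ H × q ∈ H × a ≡ glue (length h₀) p q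
  complement⊆glue {h₀} h₀∈ short {a} a∈ a∉∪H
    with complement-prefix-in-H h₀∈ a∈ a∉∪H
       | complement-prefix-in-H h₀∈ (reverse-∈𝒜 a∈) (a∉∪H ∘′ Equivalence.from (∪H-reverse⇔ a∈))
  ... | p , p∈ , p≡a | q , q∈ , q≡ra =
    p , q , p∈ , q∈ , ≡glue j p q a∈ (sym p≡a) (begin
      take j (reverse a)                ≡⟨ take-of-take (reverse a) ⟨
      take j (take (m ∸ j) (reverse a)) ≡⟨ cong (take j) q≡ra ⟨
      take j (take (m ∸ j) q)           ≡⟨ take-of-take q ⟩
      take j q                          ∎)
    where
    open ≡-Reasoning
    j = length h₀
    take-of-take : ∀ xs → take j (take (m ∸ j) xs) ≡ take j xs
    take-of-take xs = trans (take-take j (m ∸ j) xs)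
                            (cong (λ n → take n xs) (m≤n⇒m⊓n≡m (m+n≤o⇒m≤o∸n j short)))

  -- The test cardUnion filters by, so cardUnion sizes H is length (filter ∪H? 𝒜) definitionally.
  ∪H? : Decidable (InUnion H)
  ∪H? a = any? (λ h → prefix? _≟_ h a) H

  cardUnion⊓complement≤|H|² : cardUnion sizes H ⊓ (cardA sizes ∸ cardUnion sizes H) ≤ length H ^ 2
  cardUnion⊓complement≤|H|² with any? (λ h → length h + length h ≤? m) H
  ... | yes some-short with find some-short
  ...   | h₀ , h₀∈ , short = begin
    length (filter ∪H? 𝒜) ⊓ (cardA sizes ∸ length (filter ∪H? 𝒜)) ≤⟨ m⊓n≤n _ _ ⟩
    cardA sizes ∸ length (filter ∪H? 𝒜)                          ≡⟨ complement-size ⟩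
    length (filter (∁? ∪H?) 𝒜)                                   ≤⟨ count (∁? ∪H?) (glue j) (complement⊆glue h₀∈ short) ⟩
    length H ^ 2                                                ∎
    where
    open ≤-Reasoning
    j = length h₀
    complement-size : cardA sizes ∸ length (filter ∪H? 𝒜) ≡ length (filter (∁? ∪H?) 𝒜)
    complement-size = trans (cong (_∸ length (filter ∪H? 𝒜))
                              (trans (sym (length-allWords sizes)) (sym (length-filter+length-filter-∁ ∪H? 𝒜))))
                            (m+n∸m≡n (length (filter ∪H? 𝒜)) _)
  cardUnion⊓complement≤|H|² | no no-short =
    ≤-trans (m⊓n≤m _ _) (count ∪H? (λ p q → glue (length q) p q) (∪H⊆glue long))
    where
    long : ∀ {h} → h ∈ H → m ≤ length h + length h
    long h∈ = <⇒≤ (≰⇒> (λ short → no-short (lose h∈ short)))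

corollary7p9 : ∃ λ (C : ℕ) →
    ∀ (sizes : List ℕ) (H : List (List ℕ)) →
    All NonZero sizes →
    reverse sizes ≡ sizes →
    Unique H →
    All (InBar sizes) H →
    Symmetric sizes H →
    PrefixFree H →
    (cardUnion sizes H ⊓ (cardA sizes ∸ cardUnion sizes H)) * cardA sizes
      ≤ length H ^ 2 * cardA sizes + C * length H ^ 4
corollary7p9 = 0 , λ sizes H _ palindromic _ H⊆Ā symmetric _ →
  let open SymmetricFamily sizes H palindromic H⊆Ā symmetric in
  ≤-trans (*-monoˡ-≤ (cardA sizes) cardUnion⊓complement≤|H|²) (m≤m+n _ _)
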